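{- At any time during any sequence of operations on one-root hollow heaps (as defined in the context), every node of rank $r$ has at least $F_{r+3}-1$ descendants (counting itself, and counting both full and hollow nodes), where $F_0=0$, $F_1=1$, $F_i=F_{i-1}+F_{i-2}$ for $i\ge 2$.
   Context: Heaps. A heap stores a finite set of items, each with a key from a totally ordered universe, and supports: make-heap() (return an empty heap); find-min($h$) (return an item of minimum key in $h$, or null if $h$ is empty); insert($e,k,h$) (add item $e$, which is in no heap, with key $k$); delete-min($h$) (delete from non-empty $h$ the item that find-min($h$) returns); meld($h_1,h_2$) (return a heap containing all items of the item-disjoint heaps $h_1,h_2$); decrease-key($e,k,h$) (given an item $e$ in $h$ with key greater than $k$, change its key to $k$); delete($e,h$) (delete item $e$ from $h$). Heaps passed as arguments are destroyed; decrease-key and delete are given the location of $e$. Nodes. Nodes hold items: each node holds at most one item, and is full if it holds one and hollow otherwise; each item in a heap is held by exactly one node; a newly created node is full and a hollow node never becomes full again. Each node $u$ has a key $u.key$ (the current key of its item if $u$ is full; if $u$ is hollow, the key its item had just before leaving $u$) and a non-negative integer rank $u.rank$. A tree (or dag) of nodes with arcs from parent to child is heap-ordered if $v.key\le w.key$ for every arc $(v,w)$. For two full roots, link makes the one of larger key (ties broken arbitrarily) a child of the other; the new child is the loser and the other the winner. A ranked link is a link of two roots of equal rank and increases the winner's rank by one; an unranked link may be applied to any two full roots and changes no ranks. One-root hollow heap. It is either empty or a single heap-ordered rooted tree of nodes whose root is full; the root is the minimum node. A non-root node is a ranked or unranked child according to whether the link it lost was ranked or unranked; a child keeps this status when moved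 to a new parent. make-heap returns an empty heap; find-min returns the item in the root; meld returns one heap if the other is empty, and otherwise does an unranked link of the two roots; insert($e,k,h$) creates a new full node of rank 0 holding $e$ with key $k$ and melds this one-node heap with $h$. decrease-key($e,k,h$), with $u$ the node holding $e$: if $u$ is the root one may simply set $u.key=k$; otherwise create a new node $v$, move $e$ from $u$ to $v$ (so $u$ becomes hollow), set $v.key=k$ and $v.rank=\max\{0,u.rank-2\}$, move to $v$ every ranked child of $u$ of rank less than $v.rank$ and any subset of the unranked children of $u$ (with their subtrees), and meld the tree rooted at $v$ with the heap. delete($e,h$) removes $e$ from the node $u$ holding it, making $u$ hollow; if $u$ is not the root this completes the operation; otherwise, while some root is hollow, destroy such a root, making its children roots; then do ranked links while two roots have equal rank; then do unranked links until one root remains. delete-min($h$) performs delete on the item in the root. -}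

module Defs where

open import Level using (Level; _⊔_)
open import Data.Bool using (Bool; true; false)
open import Data.Nat using (ℕ; zero; suc; _+_; _∸_; _≤_; _<_)
open import Data.List using (List; []; _∷_; _++_; length)
open import Data.List.Relation.Unary.AllPairs using (AllPairs)
open import Data.Maybe using (Maybe; just; nothing)
open import Data.Product using (_×_; _,_; proj₂)
open import Relation.Binary.Bundles using (TotalOrder)
open import Relation.Binary.PropositionalEquality using (_≡_; _≢_)
open import Relation.Binary.Construct.Closure.ReflexiveTransitive using (Star)
open import Relation.Nullary using (¬_)

fib : ℕ → ℕ
fib zero = 0
fib (suc zero) = 1
fib (suc (suc n)) = fib (suc n) + fib n

data Pick {a} {A : Set a} : List A → A → List A → Set a where
  here  : ∀ {x xs} → Pick (x ∷ xs) x xs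
  there : ∀ {x y xs ys} → Pick xs y ys → Pick (x ∷ xs) y (x ∷ ys)

-- Whether a child lost a ranked or an unranked link.
data Kind : Set where
  ranked unranked : Kind

module HollowHeap {a ℓ₁ ℓ₂} (O : TotalOrder a ℓ₁ ℓ₂) where
  open TotalOrder O using () renaming (Carrier to Key; _≤_ to _≤ₖ_; _≈_ to _≈ₖ_)

  _<ₖ_ : Key → Key → Set (ℓ₁ ⊔ ℓ₂)
  x <ₖ y = x ≤ₖ y × ¬ (x ≈ₖ y)

  -- A node: full? (true = full, false = hollow), key, rank, and its
  -- children, each tagged ranked/unranked, with their subtrees.
  data Tree : Set a where
    node : Bool → Key → ℕ → List (Kind × Tree) → Tree

  rank : Tree → ℕ
  rank (node _ _ r _) = r

  mutual
    size : Tree → ℕ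
    size (node _ _ _ cs) = suc (sizes cs)

    sizes : List (Kind × Tree) → ℕ
    sizes [] = 0
    sizes ((_ , t) ∷ cs) = size t + sizes cs

  mutual
    data AllNodes {p} (P : Tree → Set p) : Tree → Set (a ⊔ p) where
      node : ∀ {b k r cs} → P (node b k r cs) → AllChildren P cs
           → AllNodes P (node b k r cs)

    data AllChildren {p} (P : Tree → Set p) : List (Kind × Tree) → Set (a ⊔ p) where
      []  : AllChildren P []
      _∷_ : ∀ {κ t cs} → AllNodes P t → AllChildren P cs → AllChildren P ((κ , t) ∷ cs)

  Heap : Set a
  Heap = Maybe Tree

  data AllHeapNodes {p} (P : Tree → Set p) : Heap → Set (a ⊔ p) where
    empty : AllHeapNodes P nothing
    tree  : ∀ {t} → AllNodes P t → AllHeapNodes P (just t)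

  incr : Kind → ℕ → ℕ
  incr ranked r = suc r
  incr unranked r = r

  -- Link κ t₁ t₂ t : t results from linking the full roots t₁ and t₂;
  -- the root of smaller key wins (ties broken arbitrarily).
  data CanLink : Kind → ℕ → ℕ → Set where
    rk : ∀ {r} → CanLink ranked r r
    uk : ∀ {r₁ r₂} → CanLink unranked r₁ r₂

  data Link (κ : Kind) : Tree → Tree → Tree → Set (a ⊔ ℓ₂) where
    left  : ∀ {k₁ r₁ cs₁ k₂ r₂ cs₂} → CanLink κ r₁ r₂ → k₁ ≤ₖ k₂ →
            Link κ (node true k₁ r₁ cs₁) (node true k₂ r₂ cs₂)
                   (node true k₁ (incr κ r₁) ((κ , node true k₂ r₂ cs₂) ∷ cs₁))
    right : ∀ {k₁ r₁ cs₁ k₂ r₂ cs₂} → CanLink κ r₁ r₂ → k₂ ≤ₖ k₁ →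
            Link κ (node true k₁ r₁ cs₁) (node true k₂ r₂ cs₂)
                   (node true k₂ (incr κ r₂) ((κ , node true k₁ r₁ cs₁) ∷ cs₂))

  data Meld : Heap → Heap → Heap → Set (a ⊔ ℓ₂) where
    emptyˡ : ∀ {h} → Meld nothing h h
    emptyʳ : ∀ {h} → Meld h nothing h
    link   : ∀ {t₁ t₂ t} → Link unranked t₁ t₂ t → Meld (just t₁) (just t₂) (just t)

  data Sub : Tree → Tree → Tree → Tree → Set a where
    here  : ∀ {u u'} → Sub u u u' u'
    there : ∀ {b k r xs ys κ c c' u u'} → Sub c u u' c' →
            Sub (node b k r (xs ++ (κ , c) ∷ ys)) u u' (node b k r (xs ++ (κ , c') ∷ ys))

  data Inside : Tree → Tree → Tree → Tree → Set a where
    inside : ∀ {b k r xs ys κ c c' u u'} → Sub c u u' c' →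
             Inside (node b k r (xs ++ (κ , c) ∷ ys)) u u' (node b k r (xs ++ (κ , c') ∷ ys))

  -- Split r cs moved stay : the children cs of u are split into those moved
  -- to v (every ranked child of rank < r, and any subset of the unranked
  -- children) and those that stay with u.
  data Split (r : ℕ) : List (Kind × Tree) → List (Kind × Tree) → List (Kind × Tree) → Set a where
    []       : Split r [] [] []
    rk-move  : ∀ {t cs mv st} → rank t < r → Split r cs mv st →
               Split r ((ranked , t) ∷ cs) ((ranked , t) ∷ mv) st
    rk-stay  : ∀ {t cs mv st} → r ≤ rank t → Split r cs mv st →
               Split r ((ranked , t) ∷ cs) mv ((ranked , t) ∷ st)
    un-move  : ∀ {t cs mv st} → Split r cs mv st →
               Split r ((unranked , t) ∷ cs) ((unranked , t) ∷ mv) st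
    un-stay  : ∀ {t cs mv st} → Split r cs mv st →
               Split r ((unranked , t) ∷ cs) mv ((unranked , t) ∷ st)

  data DecreaseKey : Heap → Heap → Set (a ⊔ ℓ₁ ⊔ ℓ₂) where
    atRoot  : ∀ {k ku r cs} → k <ₖ ku →
              DecreaseKey (just (node true ku r cs)) (just (node true k r cs))
    nonRoot : ∀ {t t' t'' k ku r cs mv st} → k <ₖ ku →
              Inside t (node true ku r cs) (node false ku r st) t' →
              Split (r ∸ 2) cs mv st →
              Link unranked t' (node true k (r ∸ 2) mv) t'' →
              DecreaseKey (just t) (just t'')

  -- the phases of a delete whose node is the root, on the forest of roots
  data DestroyStep : List Tree → List Tree → Set a where
    destroy : ∀ {fs k r cs rest} → Pick fs (node false k r cs) rest →
              DestroyStep fs (Data.List.map proj₂ cs ++ rest)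

  data RankedStep : List Tree → List Tree → Set (a ⊔ ℓ₂) where
    rlink : ∀ {fs t₁ t₂ t rest rest'} → Pick fs t₁ rest → Pick rest t₂ rest' →
            Link ranked t₁ t₂ t → RankedStep fs (t ∷ rest')

  data UnrankedStep : List Tree → List Tree → Set (a ⊔ ℓ₂) where
    ulink : ∀ {fs t₁ t₂ t rest rest'} → Pick fs t₁ rest → Pick rest t₂ rest' →
            Link unranked t₁ t₂ t → UnrankedStep fs (t ∷ rest')

  IsFull : Tree → Set
  IsFull (node b _ _ _) = b ≡ true

  data AllFull : List Tree → Set a where
    []  : AllFull []
    _∷_ : ∀ {t ts} → IsFull t → AllFull ts → AllFull (t ∷ ts)

  DistinctRanks : List Tree → Set a
  DistinctRanks = AllPairs (λ t₁ t₂ → rank t₁ ≢ rank t₂)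

  data Final : List Tree → Heap → Set a where
    none : Final [] nothing
    one  : ∀ {t} → Final (t ∷ []) (just t)

  data Rebuild (fs : List Tree) (h : Heap) : Set (a ⊔ ℓ₂) where
    rebuild : ∀ {fs₁ fs₂ fs₃} →
              Star DestroyStep fs fs₁ → AllFull fs₁ →
              Star RankedStep fs₁ fs₂ → DistinctRanks fs₂ →
              Star UnrankedStep fs₂ fs₃ → Final fs₃ h →
              Rebuild fs h

  -- delete(e, h), u the (full) node holding e; delete-min is the root case
  data Delete : Heap → Heap → Set (a ⊔ ℓ₂) where
    nonRoot : ∀ {t t' k r cs} →
              Inside t (node true k r cs) (node false k r cs) t' →
              Delete (just t) (just t')
    atRoot  : ∀ {k r cs h} → Rebuild (node false k r cs ∷ []) h →
              Delete (just (node true k r cs)) h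

  data Reachable : Heap → Set (a ⊔ ℓ₁ ⊔ ℓ₂) where
    make-heap    : Reachable nothing
    insert       : ∀ {k h h'} → Reachable h → Meld (just (node true k 0 [])) h h' → Reachable h'
    meld         : ∀ {h₁ h₂ h} → Reachable h₁ → Reachable h₂ → Meld h₁ h₂ h → Reachable h
    decrease-key : ∀ {h h'} → Reachable h → DecreaseKey h h' → Reachable h'
    delete       : ∀ {h h'} → Reachable h → Delete h h' → Reachable h'

  FibBound : Tree → Set
  FibBound t = fib (rank t + 3) ∸ 1 ≤ size t

module Submission where

-- The invariant: a full node of rank r has ranked children of every rank
-- j < r, and a hollow node still has ranked children of ranks r - 2 and
-- r - 1.  A ranked link gives the winner a child of its old rank; unranked
-- links, hollowing and melds change no rank; decrease-key gives the new node
-- v rank r - 2 together with all ranked children of u below r - 2, while u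
-- keeps those of ranks r - 2 and r - 1.  Rebuilding after a delete-min only
-- destroys roots and links.  Given the invariant, a node of rank r + 2 has
-- two ranked children of ranks r + 1 and r, so by induction on rank its size
-- is at least 1 + (F (r+4) - 1) + (F (r+3) - 1) = F (r+5) - 1.

open import Defs
open import Relation.Binary.Bundles using (TotalOrder)
open import Data.Nat using (ℕ; zero; suc; _+_; _∸_; _≤_; _<_; z≤n; s≤s)
open import Data.Nat.Properties
  using (≤-refl; ≤-trans; m≤m+n; m≤n+m; +-suc; +-comm; <⇒≱; <⇒≢; n<1+n; n≤1+n; m∸n≤m;
         +-mono-≤; m<1+n⇒m<n∨m≡n; module ≤-Reasoning)
open import Data.Bool using (true; false)
open import Data.List using (List; []; _∷_; _++_; map)
open import Data.List.Relation.Unary.All using (All; []; _∷_)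
open import Data.List.Relation.Unary.All.Properties using (++⁺)
open import Data.Product using (_×_; _,_; proj₁; proj₂)
open import Data.Sum using (_⊎_; inj₁; inj₂)
open import Data.Empty using (⊥-elim)
open import Function using (_∘_; id)
open import Relation.Binary.PropositionalEquality using (_≡_; _≢_; refl; sym; trans; subst)
open import Relation.Binary.Construct.Closure.ReflexiveTransitive using (Star; fold)

m+n∸1≡1+[m∸1]+[n∸1] : ∀ {m n} → 0 < m → 0 < n → m + n ∸ 1 ≡ suc (m ∸ 1 + (n ∸ 1))
m+n∸1≡1+[m∸1]+[n∸1] {suc m} {suc n} _ _ = +-suc m n

0<fib : ∀ n → 0 < n → 0 < fib n
0<fib (suc zero)    _ = s≤s z≤n
0<fib (suc (suc n)) _ = ≤-trans (0<fib (suc n) (s≤s z≤n)) (m≤m+n _ _)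

Star-preserves : ∀ {i r q} {I : Set i} {R : I → I → Set r} (Q : I → Set q) →
                 (∀ {x y} → R x y → Q x → Q y) → ∀ {x y} → Star R x y → Q x → Q y
Star-preserves Q pres = fold (λ x y → Q x → Q y) (λ step k → k ∘ pres step) id

module FibonacciBound {a ℓ₁ ℓ₂} (O : TotalOrder a ℓ₁ ℓ₂) where
  open HollowHeap O

  minSize : ℕ → ℕ
  minSize r = fib (r + 3) ∸ 1

  minSize-suc-suc : ∀ m → minSize (suc (suc m)) ≡ suc (minSize (suc m) + minSize m)
  minSize-suc-suc m = m+n∸1≡1+[m∸1]+[n∸1] (0<fib (suc m + 3) (s≤s z≤n))
                                             (0<fib (m + 3) (≤-trans (s≤s z≤n) (m≤n+m 3 m)))

  AllNodes-root : ∀ {p} {P : Tree → Set p} {t} → AllNodes P t → P t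
  AllNodes-root (node p _) = p

  AllChildren-++⁻ : ∀ {p} {P : Tree → Set p} xs {κ c ys} → AllChildren P (xs ++ (κ , c) ∷ ys) →
                    AllChildren P xs × AllNodes P c × AllChildren P ys
  AllChildren-++⁻ []       (pc ∷ pys) = [] , pc , pys
  AllChildren-++⁻ (_ ∷ xs) (px ∷ ps) with AllChildren-++⁻ xs ps
  ... | pxs , pc , pys = px ∷ pxs , pc , pys

  AllChildren-++⁺ : ∀ {p} {P : Tree → Set p} {xs κ c ys} → AllChildren P xs → AllNodes P c →
                    AllChildren P ys → AllChildren P (xs ++ (κ , c) ∷ ys)
  AllChildren-++⁺ []         pc pys = pc ∷ pys
  AllChildren-++⁺ (px ∷ pxs) pc pys = px ∷ AllChildren-++⁺ pxs pc pys

  AllChildren⇒All : ∀ {p} {P : Tree → Set p} {cs} → AllChildren P cs → All (AllNodes P) (map proj₂ cs)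
  AllChildren⇒All []         = []
  AllChildren⇒All (pc ∷ pcs) = pc ∷ AllChildren⇒All pcs

  mutual
    AllNodes-bottomUp : ∀ {p q} {P : Tree → Set p} {Q : Tree → Set q} →
                        (∀ {b k r cs} → P (node b k r cs) → AllChildren Q cs → Q (node b k r cs)) →
                        ∀ {t} → AllNodes P t → AllNodes Q t
    AllNodes-bottomUp step (node p pcs) = node (step p qcs) qcs
      where qcs = AllChildren-bottomUp step pcs

    AllChildren-bottomUp : ∀ {p q} {P : Tree → Set p} {Q : Tree → Set q} →
                           (∀ {b k r cs} → P (node b k r cs) → AllChildren Q cs → Q (node b k r cs)) →
                           ∀ {cs} → AllChildren P cs → AllChildren Q cs
    AllChildren-bottomUp step []         = []
    AllChildren-bottomUp step (pc ∷ pcs) = AllNodes-bottomUp step pc ∷ AllChildren-bottomUp step pcs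

  Sub-rank : ∀ {t u u' t'} → Sub t u u' t' → rank u ≡ rank u' → rank t ≡ rank t'
  Sub-rank here      eq = eq
  Sub-rank (there _) _  = refl

  AllNodes-Sub : ∀ {p} {P : Tree → Set p} {t u u' t'} → Sub t u u' t' → AllNodes P t → AllNodes P u
  AllNodes-Sub here                  pt           = pt
  AllNodes-Sub (there {xs = xs} sub) (node _ pcs) = AllNodes-Sub sub (proj₁ (proj₂ (AllChildren-++⁻ xs pcs)))

  data HasRankedChild (j : ℕ) : List (Kind × Tree) → Set a where
    here  : ∀ {t cs} → rank t ≡ j → HasRankedChild j ((ranked , t) ∷ cs)
    there : ∀ {c cs} → HasRankedChild j cs → HasRankedChild j (c ∷ cs)

  HasRankedChild-replace : ∀ xs {κ c c' ys j} → rank c ≡ rank c' →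
                           HasRankedChild j (xs ++ (κ , c) ∷ ys) → HasRankedChild j (xs ++ (κ , c') ∷ ys)
  HasRankedChild-replace []       eq (here rc≡j)  = here (trans (sym eq) rc≡j)
  HasRankedChild-replace []       eq (there has) = there has
  HasRankedChild-replace (_ ∷ xs) eq (here rc≡j)  = here rc≡j
  HasRankedChild-replace (_ ∷ xs) eq (there has) = there (HasRankedChild-replace xs eq has)

  HasRankedChild-stay : ∀ {s cs mv st j} → Split s cs mv st → HasRankedChild j cs → s ≤ j → HasRankedChild j st
  HasRankedChild-stay (rk-move r<s _) (here refl) s≤j = ⊥-elim (<⇒≱ r<s s≤j)
  HasRankedChild-stay (rk-move _ sp)  (there has) s≤j = HasRankedChild-stay sp has s≤j
  HasRankedChild-stay (rk-stay _ _)   (here eq)   s≤j = here eq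
  HasRankedChild-stay (rk-stay _ sp)  (there has) s≤j = there (HasRankedChild-stay sp has s≤j)
  HasRankedChild-stay (un-move sp)    (there has) s≤j = HasRankedChild-stay sp has s≤j
  HasRankedChild-stay (un-stay sp)    (there has) s≤j = there (HasRankedChild-stay sp has s≤j)

  HasRankedChild-move : ∀ {s cs mv st j} → Split s cs mv st → HasRankedChild j cs → j < s → HasRankedChild j mv
  HasRankedChild-move (rk-move _ _)   (here eq)   j<s = here eq
  HasRankedChild-move (rk-move _ sp)  (there has) j<s = there (HasRankedChild-move sp has j<s)
  HasRankedChild-move (rk-stay s≤r _) (here refl) j<s = ⊥-elim (<⇒≱ j<s s≤r)
  HasRankedChild-move (rk-stay _ sp)  (there has) j<s = HasRankedChild-move sp has j<s
  HasRankedChild-move (un-move sp)    (there has) j<s = there (HasRankedChild-move sp has j<s)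
  HasRankedChild-move (un-stay sp)    (there has) j<s = HasRankedChild-move sp has j<s

  AllChildren-split : ∀ {p} {P : Tree → Set p} {s cs mv st} → Split s cs mv st → AllChildren P cs →
                      AllChildren P mv × AllChildren P st
  AllChildren-split []              []         = [] , []
  AllChildren-split (rk-move _ sp) (pc ∷ pcs) with AllChildren-split sp pcs
  ... | pmv , pst = pc ∷ pmv , pst
  AllChildren-split (rk-stay _ sp) (pc ∷ pcs) with AllChildren-split sp pcs
  ... | pmv , pst = pmv , pc ∷ pst
  AllChildren-split (un-move sp)   (pc ∷ pcs) with AllChildren-split sp pcs
  ... | pmv , pst = pc ∷ pmv , pst
  AllChildren-split (un-stay sp)   (pc ∷ pcs) with AllChildren-split sp pcs
  ... | pmv , pst = pmv , pc ∷ pst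

  HasRankedChild⇒minSize≤ : ∀ {j cs} → AllChildren FibBound cs → HasRankedChild j cs → minSize j ≤ sizes cs
  HasRankedChild⇒minSize≤ {cs = (_ , t) ∷ cs} (pt ∷ _)   (here refl) = ≤-trans (AllNodes-root pt) (m≤m+n (size t) (sizes cs))
  HasRankedChild⇒minSize≤ {cs = (_ , t) ∷ cs} (_  ∷ pcs) (there has) =
    ≤-trans (HasRankedChild⇒minSize≤ pcs has) (m≤n+m (sizes cs) (size t))

  HasRankedChildren⇒minSize≤ : ∀ {i j cs} → i ≢ j → AllChildren FibBound cs →
                               HasRankedChild i cs → HasRankedChild j cs → minSize i + minSize j ≤ sizes cs
  HasRankedChildren⇒minSize≤ i≢j _ (here refl) (here refl) = ⊥-elim (i≢j refl)
  HasRankedChildren⇒minSize≤ i≢j (pt ∷ pcs) (here refl) (there hj) =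
    +-mono-≤ (AllNodes-root pt) (HasRankedChild⇒minSize≤ pcs hj)
  HasRankedChildren⇒minSize≤ {i} {j} {(_ , t) ∷ cs} i≢j (pt ∷ pcs) (there hi) (here refl) =
    subst (_≤ size t + sizes cs) (+-comm (minSize j) (minSize i))
      (+-mono-≤ (AllNodes-root pt) (HasRankedChild⇒minSize≤ pcs hi))
  HasRankedChildren⇒minSize≤ {cs = (_ , t) ∷ cs} i≢j (_ ∷ pcs) (there hi) (there hj) =
    ≤-trans (HasRankedChildren⇒minSize≤ i≢j pcs hi hj) (m≤n+m (sizes cs) (size t))

  WellRanked : Tree → Set a
  WellRanked (node b _ r cs) = ∀ {j} → j < r → b ≡ true ⊎ r ∸ 2 ≤ j → HasRankedChild j cs

  WellRanked⇒FibBound : ∀ {b k r cs} → WellRanked (node b k r cs) → AllChildren FibBound cs →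
                        FibBound (node b k r cs)
  WellRanked⇒FibBound {r = zero}        _  _   = s≤s z≤n
  WellRanked⇒FibBound {r = suc zero}    wr pcs = s≤s (HasRankedChild⇒minSize≤ pcs (wr (s≤s z≤n) (inj₂ z≤n)))
  WellRanked⇒FibBound {r = suc (suc m)} {cs = cs} wr pcs = begin
    minSize (suc (suc m))              ≡⟨ minSize-suc-suc m ⟩
    suc (minSize (suc m) + minSize m)  ≤⟨ s≤s (HasRankedChildren⇒minSize≤ (<⇒≢ (n<1+n m) ∘ sym) pcs
                                                 (wr (n<1+n (suc m)) (inj₂ (n≤1+n m)))
                                                 (wr (s≤s (n≤1+n m)) (inj₂ ≤-refl))) ⟩
    suc (sizes cs)                     ∎
    where open ≤-Reasoning

  AllNodes-WellRanked-hollow : ∀ {k r cs} → AllNodes WellRanked (node true k r cs) →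
                               AllNodes WellRanked (node false k r cs)
  AllNodes-WellRanked-hollow (node wr wcs) = node (λ j<r _ → wr j<r (inj₁ refl)) wcs

  AllNodes-WellRanked-stay : ∀ {k r cs mv st} → Split (r ∸ 2) cs mv st →
                             AllNodes WellRanked (node true k r cs) → AllNodes WellRanked (node false k r st)
  AllNodes-WellRanked-stay split (node wr wcs) =
    node (λ { j<r (inj₂ r∸2≤j) → HasRankedChild-stay split (wr j<r (inj₁ refl)) r∸2≤j })
         (proj₂ (AllChildren-split split wcs))

  AllNodes-WellRanked-move : ∀ {k k' r cs mv st} → Split (r ∸ 2) cs mv st →
                             AllNodes WellRanked (node true k r cs) → AllNodes WellRanked (node true k' (r ∸ 2) mv)
  AllNodes-WellRanked-move {r = r} split (node wr wcs) =
    node (λ j<r∸2 _ → HasRankedChild-move split (wr (≤-trans j<r∸2 (m∸n≤m r 2)) (inj₁ refl)) j<r∸2)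
         (proj₁ (AllChildren-split split wcs))

  AllNodes-WellRanked-Sub : ∀ {t u u' t'} → Sub t u u' t' → rank u ≡ rank u' → AllNodes WellRanked t →
                            (AllNodes WellRanked u → AllNodes WellRanked u') → AllNodes WellRanked t'
  AllNodes-WellRanked-Sub here _ wt replace = replace wt
  AllNodes-WellRanked-Sub (there {xs = xs} sub) eq (node wr wcs) replace with AllChildren-++⁻ xs wcs
  ... | wxs , wc , wys =
    node (λ j<r q → HasRankedChild-replace xs (Sub-rank sub eq) (wr j<r q))
         (AllChildren-++⁺ wxs (AllNodes-WellRanked-Sub sub eq wc replace) wys)

  CanLink-sym : ∀ {κ r s} → CanLink κ r s → CanLink κ s r
  CanLink-sym rk = rk
  CanLink-sym uk = uk

  AllNodes-WellRanked-winner : ∀ {κ k r cs t} → CanLink κ r (rank t) →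
                               AllNodes WellRanked (node true k r cs) → AllNodes WellRanked t →
                               AllNodes WellRanked (node true k (incr κ r) ((κ , t) ∷ cs))
  AllNodes-WellRanked-winner {k = k} {r} {cs} {t} can (node wr wcs) wt = node (winner can) (wt ∷ wcs)
    where
      winner : ∀ {κ} → CanLink κ r (rank t) → WellRanked (node true k (incr κ r) ((κ , t) ∷ cs))
      winner rk j<1+r _ with m<1+n⇒m<n∨m≡n j<1+r
      ... | inj₁ j<r  = there (wr j<r (inj₁ refl))
      ... | inj₂ refl = here refl
      winner uk j<r _ = there (wr j<r (inj₁ refl))

  Link-WellRanked : ∀ {κ t₁ t₂ t} → Link κ t₁ t₂ t →
                    AllNodes WellRanked t₁ → AllNodes WellRanked t₂ → AllNodes WellRanked t
  Link-WellRanked (left  can _) wt₁ wt₂ = AllNodes-WellRanked-winner can wt₁ wt₂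
  Link-WellRanked (right can _) wt₁ wt₂ = AllNodes-WellRanked-winner (CanLink-sym can) wt₂ wt₁

  WellRankedForest : List Tree → Set a
  WellRankedForest = All (AllNodes WellRanked)

  All-pick : ∀ {p} {P : Tree → Set p} {fs t rest} → Pick fs t rest → All P fs → P t × All P rest
  All-pick here       (pt ∷ ps) = pt , ps
  All-pick (there pk) (pf ∷ ps) with All-pick pk ps
  ... | pt , prest = pt , pf ∷ prest

  LinkPicked-WellRanked : ∀ {κ fs t₁ t₂ t rest rest'} → Pick fs t₁ rest → Pick rest t₂ rest' →
                          Link κ t₁ t₂ t → WellRankedForest fs → WellRankedForest (t ∷ rest')
  LinkPicked-WellRanked pick₁ pick₂ lk wfs with All-pick pick₁ wfs
  ... | wt₁ , wrest with All-pick pick₂ wrest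
  ... | wt₂ , wrest' = Link-WellRanked lk wt₁ wt₂ ∷ wrest'

  DestroyStep-WellRanked : ∀ {fs fs'} → DestroyStep fs fs' → WellRankedForest fs → WellRankedForest fs'
  DestroyStep-WellRanked (destroy pick) wfs with All-pick pick wfs
  ... | node _ wcs , wrest = ++⁺ (AllChildren⇒All wcs) wrest

  RankedStep-WellRanked : ∀ {fs fs'} → RankedStep fs fs' → WellRankedForest fs → WellRankedForest fs'
  RankedStep-WellRanked (rlink pick₁ pick₂ lk) = LinkPicked-WellRanked pick₁ pick₂ lk

  UnrankedStep-WellRanked : ∀ {fs fs'} → UnrankedStep fs fs' → WellRankedForest fs → WellRankedForest fs'
  UnrankedStep-WellRanked (ulink pick₁ pick₂ lk) = LinkPicked-WellRanked pick₁ pick₂ lk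

  Rebuild-WellRanked : ∀ {fs h} → Rebuild fs h → WellRankedForest fs → AllHeapNodes WellRanked h
  Rebuild-WellRanked (rebuild destroys _ rlinks _ ulinks final) =
    fromFinal final ∘ Star-preserves WellRankedForest UnrankedStep-WellRanked ulinks
                    ∘ Star-preserves WellRankedForest RankedStep-WellRanked rlinks
                    ∘ Star-preserves WellRankedForest DestroyStep-WellRanked destroys
    where
      fromFinal : ∀ {fs h} → Final fs h → WellRankedForest fs → AllHeapNodes WellRanked h
      fromFinal none []        = empty
      fromFinal one  (wt ∷ []) = tree wt

  Meld-WellRanked : ∀ {h₁ h₂ h} → Meld h₁ h₂ h →
                    AllHeapNodes WellRanked h₁ → AllHeapNodes WellRanked h₂ → AllHeapNodes WellRanked h
  Meld-WellRanked emptyˡ    _          wh₂        = wh₂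
  Meld-WellRanked emptyʳ    wh₁        _          = wh₁
  Meld-WellRanked (link lk) (tree wt₁) (tree wt₂) = tree (Link-WellRanked lk wt₁ wt₂)

  DecreaseKey-WellRanked : ∀ {h h'} → DecreaseKey h h' → AllHeapNodes WellRanked h → AllHeapNodes WellRanked h'
  DecreaseKey-WellRanked (atRoot _) (tree (node wr wcs)) = tree (node wr wcs)
  DecreaseKey-WellRanked (nonRoot _ (inside sub) split lk) (tree wt) =
    tree (Link-WellRanked lk (AllNodes-WellRanked-Sub (there sub) refl wt (AllNodes-WellRanked-stay split))
                             (AllNodes-WellRanked-move split (AllNodes-Sub (there sub) wt)))

  Delete-WellRanked : ∀ {h h'} → Delete h h' → AllHeapNodes WellRanked h → AllHeapNodes WellRanked h'
  Delete-WellRanked (nonRoot (inside sub)) (tree wt) =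
    tree (AllNodes-WellRanked-Sub (there sub) refl wt AllNodes-WellRanked-hollow)
  Delete-WellRanked (atRoot rb) (tree wt) = Rebuild-WellRanked rb (AllNodes-WellRanked-hollow wt ∷ [])

  Reachable-WellRanked : ∀ {h} → Reachable h → AllHeapNodes WellRanked h
  Reachable-WellRanked make-heap           = empty
  Reachable-WellRanked (insert rh m)       = Meld-WellRanked m (tree (node (λ ()) [])) (Reachable-WellRanked rh)
  Reachable-WellRanked (meld rh₁ rh₂ m)    = Meld-WellRanked m (Reachable-WellRanked rh₁) (Reachable-WellRanked rh₂)
  Reachable-WellRanked (decrease-key rh d) = DecreaseKey-WellRanked d (Reachable-WellRanked rh)
  Reachable-WellRanked (delete rh d)       = Delete-WellRanked d (Reachable-WellRanked rh)

  WellRanked⇒FibBound-heap : ∀ {h} → AllHeapNodes WellRanked h → AllHeapNodes FibBound h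
  WellRanked⇒FibBound-heap empty     = empty
  -- the key of a node is invisible in both WellRanked and FibBound, so it must be passed by hand
  WellRanked⇒FibBound-heap (tree wt) = tree (AllNodes-bottomUp (λ {k = k} → WellRanked⇒FibBound {k = k}) wt)

lemma3p2 : ∀ {a ℓ₁ ℓ₂} (O : TotalOrder a ℓ₁ ℓ₂) {h : HollowHeap.Heap O} →
           HollowHeap.Reachable O h → HollowHeap.AllHeapNodes O (HollowHeap.FibBound O) h
lemma3p2 O = WellRanked⇒FibBound-heap ∘ Reachable-WellRanked
  where open FibonacciBound O
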